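{- Let $G$ be a finite abelian group, $S=\{s,-s,s',-s',s_0\}\subseteq G\setminus\{0\}$ a generating set of $G$ with $|S|=5$, $o(s_0)=2$ and $o(s),o(s')>2$, and $\Gamma=\mathrm{Cay}(G,S)$. For integers $i,j,k$ let $x(i,j,k)=is+js'+ks_0$. Let $D$ be a perfect code of $\Gamma$. If $x(i,j,k)\in D$, then for every integer $l$, $x(i+l,j+l,k+l)\in D$ or $x(i-l,j+l,k+l)\in D$.
   Context: $\mathrm{Cay}(G,S)$ has vertex set $G$ with $x\sim y$ iff $y-x\in S$. A perfect code is a vertex set $C$ such that every vertex is at distance at most $1$ from exactly one vertex of $C$. $o(x)$ is the order of $x$. -}

module Defs where

open import Level using (_⊔_)
open import Algebra.Bundles using (AbelianGroup)
open import Data.Integer using (ℤ; +_; -[1+_])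
open import Data.Nat using (ℕ; zero; suc; _≤_; _<_)
open import Data.List using (List; []; _∷_)
import Data.List.Membership.Setoid as SetoidMembership
open import Data.Product using (Σ; _×_)
open import Data.Sum using (_⊎_)
open import Relation.Nullary using (¬_)

module _ {c ℓ} (G : AbelianGroup c ℓ) where
  open AbelianGroup G
  open SetoidMembership setoid using (_∈_)

  _×ₙ_ : ℕ → Carrier → Carrier
  zero ×ₙ x = ε
  suc n ×ₙ x = x ∙ (n ×ₙ x)

  _·_ : ℤ → Carrier → Carrier
  (+ n) · x = n ×ₙ x
  -[1+ n ] · x = (suc n ×ₙ x) ⁻¹

  IsFinite : Set (c ⊔ ℓ)
  IsFinite = Σ (List Carrier) λ xs → ∀ x → x ∈ xs

  data Generated (S : List Carrier) : Carrier → Set (c ⊔ ℓ) where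
    gen   : ∀ {x} → x ∈ S → Generated S x
    gen-ε : Generated S ε
    gen-∙ : ∀ {x y} → Generated S x → Generated S y → Generated S (x ∙ y)
    gen-⁻¹ : ∀ {x} → Generated S x → Generated S (x ⁻¹)

  Generates : List Carrier → Set (c ⊔ ℓ)
  Generates S = ∀ x → Σ Carrier λ y → Generated S y × (x ≈ y)

  HasOrder : Carrier → ℕ → Set ℓ
  HasOrder x n = (1 ≤ n) × (n ×ₙ x ≈ ε) × (∀ m → 1 ≤ m → m < n → ¬ (m ×ₙ x ≈ ε))

  OrderGreaterThan : Carrier → ℕ → Set ℓ
  OrderGreaterThan x k = Σ ℕ λ n → HasOrder x n × (k < n)

  Adjacent : List Carrier → Carrier → Carrier → Set (c ⊔ ℓ)
  Adjacent S x y = (y ∙ x ⁻¹) ∈ S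

  Within1 : List Carrier → Carrier → Carrier → Set (c ⊔ ℓ)
  Within1 S x c = (x ≈ c) ⊎ Adjacent S c x

  IsPerfectCode : List Carrier → List Carrier → Set (c ⊔ ℓ)
  IsPerfectCode S D =
    ∀ x → (Σ Carrier λ d → d ∈ D × Within1 S x d)
        × (∀ d d' → d ∈ D → d' ∈ D → Within1 S x d → Within1 S x d' → d ≈ d')

  S₅ : Carrier → Carrier → Carrier → List Carrier
  S₅ s s' s₀ = s ∷ s ⁻¹ ∷ s' ∷ s' ⁻¹ ∷ s₀ ∷ []

  xpt : Carrier → Carrier → Carrier → ℤ → ℤ → ℤ → Carrier
  xpt s s' s₀ i j k = ((i · s) ∙ (j · s')) ∙ (k · s₀)

{-# OPTIONS --safe #-}
module Submission where

-- Coordinatise G around a codeword x by (a , b , c) ↦ x + a s + b s' + c s₀. The codewords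
-- dominating x + s' + s₀, x + s + s' and x + s + s' + s₀ are pinned down by a short case
-- analysis, each wrong case putting two codewords within distance 1 of a common vertex:
-- every codeword y has y + s + s' + s₀ ∈ D or y − s + s' + s₀ ∈ D, and y + 2s' ∉ D since
-- y + s' would be dominated twice. The two steps add up to 2s' + 2s₀ = 2s', so the first
-- step taken from x is repeated forever, giving a ray x + n(±s + s' + s₀), n ≥ 0. The same
-- argument for −s, −s', −s₀, which span the same connection set, gives the rays with n ≤ 0.

open import Defs hiding (_×ₙ_; _·_)
import Defs
open import Algebra.Bundles using (AbelianGroup)
open import Data.Integer using (ℤ; _+_; _-_)
open import Data.List.Relation.Unary.All using (All)
open import Data.List.Relation.Unary.AllPairs using (AllPairs)
open import Data.List.Membership.Setoid using (_∈_)
open import Data.Sum using (_⊎_)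
open import Relation.Nullary using (¬_)
open import Relation.Binary using (Decidable)

open import Data.Integer using (+_; -[1+_]; -_; _⊖_)
import Data.Integer.Literals as ℤ-literals
import Data.Nat.Literals as ℕ-literals
open import Agda.Builtin.FromNat using (fromNat)
open import Data.Unit.Base using (tt)
import Data.Integer.Properties as ℤₚ
open import Data.Nat as ℕ using (zero; suc)
import Data.Nat.Properties as ℕₚ
open import Data.Fin using (Fin; zero; suc)
open import Data.List using (List; _∷_; lookup)
import Data.List.Relation.Unary.All as All
import Data.List.Relation.Unary.Any as Any
open import Data.List.Relation.Unary.AllPairs using (_∷_)
open import Data.List.Relation.Unary.Any.Properties using (lookup-index)
open import Data.List.Membership.Propositional.Properties using () renaming (∈-lookup to ∈ₚ-lookup)
open import Data.Product using (Σ; _×_; _,_; proj₁; proj₂)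
import Data.Sum as Sum
open import Data.Sum using (inj₁; inj₂)
open import Data.Empty using (⊥-elim)
open import Function using (_∘_)
open import Relation.Nullary using (contradiction)
open import Relation.Binary.PropositionalEquality as P using (_≡_)

instance
  ℕ-number = ℕ-literals.number
  ℤ-number = ℤ-literals.number
  ℤ-negative = ℤ-literals.negative
  ℤ-literal-constraint = tt

Coord : Set
Coord = ℤ × ℤ × ℤ

infixl 6 _⊟_
_⊟_ : Coord → Coord → Coord
(a , b , c) ⊟ (a' , b' , c') = a - a' , b - b' , c - c'

module _ {c ℓ} (G : AbelianGroup c ℓ) where
  open AbelianGroup G hiding (_-_)
  open import Algebra.Properties.AbelianGroup G
  open import Algebra.Properties.CommutativeSemigroup commutativeSemigroup using (interchange)
  open import Algebra.Properties.CommutativeMonoid.Mult commutativeMonoid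
    using (×-congʳ; ×-homo-+; ×-distrib-+) renaming (_×_ to _×ₙ_)
  open import Relation.Binary.Reasoning.Setoid setoid
  open import Relation.Binary.Properties.Setoid setoid using (≉-sym; ≉-resp₂)
  open import Data.List.Membership.Setoid setoid using () renaming (_∈_ to _∈ᴳ_)
  open import Data.List.Membership.Setoid.Properties using (∈-resp-≈; ∈-lookup)
  open import Data.List.Relation.Binary.Permutation.Setoid setoid using (_↭_; ↭-sym; ↭-refl; prep; swap)
  open import Data.List.Relation.Binary.Permutation.Setoid.Properties setoid
    using (∈-resp-↭; AllPairs-resp-↭)

  infixr 7.5 _·_
  _·_ : ℤ → Carrier → Carrier
  _·_ = Defs._·_ G

  Defs-×ₙ≡×ₙ : ∀ n x → Defs._×ₙ_ G n x ≡ n ×ₙ x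
  Defs-×ₙ≡×ₙ zero x = P.refl
  Defs-×ₙ≡×ₙ (suc n) x = P.cong (x ∙_) (Defs-×ₙ≡×ₙ n x)

  +·≈×ₙ : ∀ n x → (+ n) · x ≈ n ×ₙ x
  +·≈×ₙ n x = reflexive (Defs-×ₙ≡×ₙ n x)

  -[1+]·≈×ₙ : ∀ n x → -[1+ n ] · x ≈ (suc n ×ₙ x) ⁻¹
  -[1+]·≈×ₙ n x = ⁻¹-cong (+·≈×ₙ (suc n) x)

  ×ₙ-⁻¹ : ∀ n x → n ×ₙ (x ⁻¹) ≈ (n ×ₙ x) ⁻¹
  ×ₙ-⁻¹ zero x = sym ε⁻¹≈ε
  ×ₙ-⁻¹ (suc n) x = trans (∙-congˡ (×ₙ-⁻¹ n x)) (⁻¹-∙-comm x (n ×ₙ x))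

  xy∙[xz]⁻¹≈y∙z⁻¹ : ∀ x y z → (x ∙ y) ∙ (x ∙ z) ⁻¹ ≈ y ∙ z ⁻¹
  xy∙[xz]⁻¹≈y∙z⁻¹ x y z = begin
    (x ∙ y) ∙ (x ∙ z) ⁻¹      ≈⟨ ∙-congˡ (⁻¹-∙-comm x z) ⟨
    (x ∙ y) ∙ (x ⁻¹ ∙ z ⁻¹)   ≈⟨ interchange x y (x ⁻¹) (z ⁻¹) ⟩
    (x ∙ x ⁻¹) ∙ (y ∙ z ⁻¹)   ≈⟨ ∙-congʳ (inverseʳ x) ⟩
    ε ∙ (y ∙ z ⁻¹)            ≈⟨ identityˡ _ ⟩
    y ∙ z ⁻¹                  ∎

  x∙[x∙y⁻¹]⁻¹≈y : ∀ x y → x ∙ (x ∙ y ⁻¹) ⁻¹ ≈ y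
  x∙[x∙y⁻¹]⁻¹≈y x y = begin
    x ∙ (x ∙ y ⁻¹) ⁻¹  ≈⟨ ∙-congˡ (⁻¹-anti-homo‿- x y) ⟩
    x ∙ (y ∙ x ⁻¹)     ≈⟨ assoc x y (x ⁻¹) ⟨
    x ∙ y ∙ x ⁻¹       ≈⟨ xyx⁻¹≈y x y ⟩
    y                  ∎

  ⊖-· : ∀ m n x → (m ⊖ n) · x ≈ m ×ₙ x ∙ (n ×ₙ x) ⁻¹
  ⊖-· m zero x = begin
    (m ⊖ 0) · x        ≈⟨ +·≈×ₙ m x ⟩
    m ×ₙ x             ≈⟨ identityʳ _ ⟨
    m ×ₙ x ∙ ε         ≈⟨ ∙-congˡ ε⁻¹≈ε ⟨
    m ×ₙ x ∙ ε ⁻¹      ∎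
  ⊖-· zero (suc n) x = trans (-[1+]·≈×ₙ n x) (sym (identityˡ _))
  ⊖-· (suc m) (suc n) x = begin
    (suc m ⊖ suc n) · x            ≡⟨ P.cong (_· x) (ℤₚ.[1+m]⊖[1+n]≡m⊖n m n) ⟩
    (m ⊖ n) · x                    ≈⟨ ⊖-· m n x ⟩
    m ×ₙ x ∙ (n ×ₙ x) ⁻¹           ≈⟨ xy∙[xz]⁻¹≈y∙z⁻¹ x _ _ ⟨
    suc m ×ₙ x ∙ (suc n ×ₙ x) ⁻¹   ∎

  ·-homo-+ : ∀ a b x → (a + b) · x ≈ a · x ∙ b · x
  ·-homo-+ (+ m) (+ n) x = begin
    (+ (m ℕ.+ n)) · x          ≈⟨ +·≈×ₙ (m ℕ.+ n) x ⟩
    (m ℕ.+ n) ×ₙ x             ≈⟨ ×-homo-+ x m n ⟩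
    m ×ₙ x ∙ n ×ₙ x            ≈⟨ ∙-cong (+·≈×ₙ m x) (+·≈×ₙ n x) ⟨
    (+ m) · x ∙ (+ n) · x      ∎
  ·-homo-+ (+ m) -[1+ n ] x = begin
    (m ⊖ suc n) · x            ≈⟨ ⊖-· m (suc n) x ⟩
    m ×ₙ x ∙ (suc n ×ₙ x) ⁻¹   ≈⟨ ∙-cong (+·≈×ₙ m x) (-[1+]·≈×ₙ n x) ⟨
    (+ m) · x ∙ -[1+ n ] · x   ∎
  ·-homo-+ -[1+ m ] (+ n) x = trans (·-homo-+ (+ n) -[1+ m ] x) (comm _ _)
  ·-homo-+ -[1+ m ] -[1+ n ] x = begin
    -[1+ suc (m ℕ.+ n) ] · x                 ≈⟨ -[1+]·≈×ₙ (suc (m ℕ.+ n)) x ⟩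
    (suc (suc (m ℕ.+ n)) ×ₙ x) ⁻¹            ≡⟨ P.cong (λ k → (k ×ₙ x) ⁻¹) (ℕₚ.+-suc (suc m) n) ⟨
    ((suc m ℕ.+ suc n) ×ₙ x) ⁻¹              ≈⟨ ⁻¹-cong (×-homo-+ x (suc m) (suc n)) ⟩
    (suc m ×ₙ x ∙ suc n ×ₙ x) ⁻¹             ≈⟨ ⁻¹-∙-comm _ _ ⟨
    (suc m ×ₙ x) ⁻¹ ∙ (suc n ×ₙ x) ⁻¹        ≈⟨ ∙-cong (-[1+]·≈×ₙ m x) (-[1+]·≈×ₙ n x) ⟨
    -[1+ m ] · x ∙ -[1+ n ] · x              ∎

  ·-neg : ∀ a x → (- a) · x ≈ (a · x) ⁻¹
  ·-neg (+ zero) x = sym ε⁻¹≈ε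
  ·-neg (+ suc n) x = refl
  ·-neg -[1+ n ] x = sym (⁻¹-involutive _)

  ·-⁻¹ : ∀ a x → a · x ⁻¹ ≈ (a · x) ⁻¹
  ·-⁻¹ (+ n) x = begin
    (+ n) · x ⁻¹       ≈⟨ +·≈×ₙ n (x ⁻¹) ⟩
    n ×ₙ (x ⁻¹)        ≈⟨ ×ₙ-⁻¹ n x ⟩
    (n ×ₙ x) ⁻¹        ≈⟨ ⁻¹-cong (+·≈×ₙ n x) ⟨
    ((+ n) · x) ⁻¹     ∎
  ·-⁻¹ -[1+ n ] x = ⁻¹-cong (·-⁻¹ (+ suc n) x)

  ·-distrib-∙ : ∀ a x y → a · (x ∙ y) ≈ a · x ∙ a · y
  ·-distrib-∙ (+ n) x y = begin
    (+ n) · (x ∙ y)        ≈⟨ +·≈×ₙ n (x ∙ y) ⟩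
    n ×ₙ (x ∙ y)           ≈⟨ ×-distrib-+ x y n ⟩
    n ×ₙ x ∙ n ×ₙ y        ≈⟨ ∙-cong (+·≈×ₙ n x) (+·≈×ₙ n y) ⟨
    (+ n) · x ∙ (+ n) · y  ∎
  ·-distrib-∙ -[1+ n ] x y =
    trans (⁻¹-cong (·-distrib-∙ (+ suc n) x y)) (sym (⁻¹-∙-comm _ _))

  ·-congˡ : ∀ a {x y} → x ≈ y → a · x ≈ a · y
  ·-congˡ (+ n) {x} {y} x≈y = begin
    (+ n) · x  ≈⟨ +·≈×ₙ n x ⟩
    n ×ₙ x     ≈⟨ ×-congʳ n x≈y ⟩
    n ×ₙ y     ≈⟨ +·≈×ₙ n y ⟨
    (+ n) · y  ∎
  ·-congˡ -[1+ n ] x≈y = ⁻¹-cong (·-congˡ (+ suc n) x≈y)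

  ·-distrib-∙³ : ∀ a x y z → a · (x ∙ y ∙ z) ≈ a · x ∙ a · y ∙ a · z
  ·-distrib-∙³ a x y z = trans (·-distrib-∙ a (x ∙ y) z) (∙-congʳ (·-distrib-∙ a x y))

  ⁻¹-distrib-∙³ : ∀ x y z → x ⁻¹ ∙ y ⁻¹ ∙ z ⁻¹ ≈ (x ∙ y ∙ z) ⁻¹
  ⁻¹-distrib-∙³ x y z = trans (∙-congʳ (⁻¹-∙-comm x y)) (⁻¹-∙-comm (x ∙ y) z)

  module _ (s t u : Carrier) where

    xpt-homo : ∀ a b c a' b' c' →
      xpt G s t u (a + a') (b + b') (c + c') ≈ xpt G s t u a b c ∙ xpt G s t u a' b' c'
    xpt-homo a b c a' b' c' = begin
      (a + a') · s ∙ (b + b') · t ∙ (c + c') · u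
        ≈⟨ ∙-cong (∙-cong (·-homo-+ a a' s) (·-homo-+ b b' t)) (·-homo-+ c c' u) ⟩
      (a · s ∙ a' · s) ∙ (b · t ∙ b' · t) ∙ (c · u ∙ c' · u)
        ≈⟨ ∙-congʳ (interchange _ _ _ _) ⟩
      (a · s ∙ b · t) ∙ (a' · s ∙ b' · t) ∙ (c · u ∙ c' · u)
        ≈⟨ interchange _ _ _ _ ⟩
      (a · s ∙ b · t ∙ c · u) ∙ (a' · s ∙ b' · t ∙ c' · u) ∎

    xpt-neg : ∀ a b c → xpt G s t u (- a) (- b) (- c) ≈ xpt G s t u a b c ⁻¹
    xpt-neg a b c =
      trans (∙-cong (∙-cong (·-neg a s) (·-neg b t)) (·-neg c u)) (⁻¹-distrib-∙³ _ _ _)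

    xpt-sub : ∀ a b c a' b' c' →
      xpt G s t u (a - a') (b - b') (c - c') ≈ xpt G s t u a b c ∙ xpt G s t u a' b' c' ⁻¹
    xpt-sub a b c a' b' c' =
      trans (xpt-homo a b c (- a') (- b') (- c')) (∙-congˡ (xpt-neg a' b' c'))

    xpt-inverse-generators : ∀ a b c → xpt G (s ⁻¹) (t ⁻¹) (u ⁻¹) a b c ≈ xpt G s t u a b c ⁻¹
    xpt-inverse-generators a b c =
      trans (∙-cong (∙-cong (·-⁻¹ a s) (·-⁻¹ b t)) (·-⁻¹ c u)) (⁻¹-distrib-∙³ _ _ _)

    xpt-diagonal : ∀ l → xpt G s t u l l l ≈ l · xpt G s t u 1 1 1
    xpt-diagonal l = sym (begin
      l · xpt G s t u 1 1 1   ≈⟨ ·-congˡ l (∙-cong (∙-cong (identityʳ s) (identityʳ t)) (identityʳ u)) ⟩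
      l · (s ∙ t ∙ u)         ≈⟨ ·-distrib-∙³ l s t u ⟩
      l · s ∙ l · t ∙ l · u   ∎)

    xpt-antidiagonal : ∀ l → xpt G s t u (- l) l l ≈ l · xpt G s t u -1 1 1
    xpt-antidiagonal l = sym (begin
      l · xpt G s t u -1 1 1     ≈⟨ ·-congˡ l (∙-cong (∙-cong (⁻¹-cong (identityʳ s)) (identityʳ t)) (identityʳ u)) ⟩
      l · (s ⁻¹ ∙ t ∙ u)         ≈⟨ ·-distrib-∙³ l (s ⁻¹) t u ⟩
      l · s ⁻¹ ∙ l · t ∙ l · u   ≈⟨ ∙-congʳ (∙-congʳ (trans (·-⁻¹ l s) (sym (·-neg l s)))) ⟩
      (- l) · s ∙ l · t ∙ l · u  ∎)

  module _ {p} {P : Carrier → Set p} (P-resp : ∀ {x y} → x ≈ y → P x → P y) where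

    ray-from : ∀ {w w'} → (∀ {y} → P y → P (y ∙ w) ⊎ P (y ∙ w')) →
               (∀ {y} → P y → ¬ P (y ∙ (w ∙ w'))) →
               ∀ {x} → P x → P (x ∙ w) → ∀ n → P (x ∙ n ×ₙ w)
    ray-from step gap Px Pxw zero = P-resp (sym (identityʳ _)) Px
    ray-from {w} {w'} step gap {x} Px Pxw (suc n) =
      P-resp (assoc x w (n ×ₙ w)) (ray-from step gap Pxw Pxww n)
      where
      Pxww : P (x ∙ w ∙ w)
      Pxww with step Pxw
      ... | inj₁ Pxww = Pxww
      ... | inj₂ Pxww' = ⊥-elim (gap Px (P-resp (assoc x w w') Pxww'))

    ray : ∀ {w w'} → (∀ {y} → P y → P (y ∙ w) ⊎ P (y ∙ w')) →
          (∀ {y} → P y → ¬ P (y ∙ (w ∙ w'))) →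
          ∀ {x} → P x → (∀ n → P (x ∙ n ×ₙ w)) ⊎ (∀ n → P (x ∙ n ×ₙ w'))
    ray {w} {w'} step gap Px with step Px
    ... | inj₁ Pxw = inj₁ (ray-from step gap Px Pxw)
    ... | inj₂ Pxw' = inj₂ (ray-from (Sum.swap ∘ step) gap' Px Pxw')
      where
      gap' : ∀ {y} → P y → ¬ P (y ∙ (w' ∙ w))
      gap' Py = gap Py ∘ P-resp (∙-congˡ (comm w' w))

  Within1-resp-↭ : ∀ {S S' v d} → S ↭ S' → Within1 G S v d → Within1 G S' v d
  Within1-resp-↭ S↭S' = Sum.map₂ (∈-resp-↭ S↭S')

  IsPerfectCode-resp-↭ : ∀ {S S' D} → S ↭ S' → IsPerfectCode G S D → IsPerfectCode G S' D
  IsPerfectCode-resp-↭ {S' = S'} {D = D} S↭S' perfect v = dominated , unique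
    where
    dominated : Σ Carrier λ d → d ∈ᴳ D × Within1 G S' v d
    dominated = let d , d∈D , v~d = proj₁ (perfect v) in d , d∈D , Within1-resp-↭ S↭S' v~d
    unique : ∀ d d' → d ∈ᴳ D → d' ∈ᴳ D → Within1 G S' v d → Within1 G S' v d' → d ≈ d'
    unique d d' d∈D d'∈D v~d v~d' =
      proj₂ (perfect v) d d' d∈D d'∈D (Within1-resp-↭ (↭-sym S↭S') v~d) (Within1-resp-↭ (↭-sym S↭S') v~d')

  lookup-injective : ∀ {xs} → AllPairs _≉_ xs → ∀ i j → lookup xs i ≈ lookup xs j → i ≡ j
  lookup-injective (_ ∷ _) zero zero _ = P.refl
  lookup-injective (x≉ ∷ _) zero (suc j) x≈ = contradiction x≈ (All.lookup x≉ (∈ₚ-lookup j))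
  lookup-injective (x≉ ∷ _) (suc i) zero ≈x = contradiction (sym ≈x) (All.lookup x≉ (∈ₚ-lookup i))
  lookup-injective (_ ∷ distinct) (suc i) (suc j) e = P.cong suc (lookup-injective distinct i j e)

  module PerfectCodeS₅ (s t u : Carrier)
    (distinct : AllPairs _≉_ (ε ∷ S₅ G s t u))
    (2u≈ε : 2 ×ₙ u ≈ ε)
    (D : List Carrier) (perfect : IsPerfectCode G (S₅ G s t u) D) where

    -- The vertices within distance 1 of pt r are pt (r ⊟ unit i), where pt r minus that
    -- vertex is the i-th entry of N; as u ≈ u ⁻¹, the single offset +u covers both u-neighbours.
    N : List Carrier
    N = ε ∷ S₅ G s t u

    X : Coord → Carrier
    X (a , b , c) = xpt G s t u a b c

    pattern same = zero
    pattern +s = suc zero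
    pattern -s = suc (suc zero)
    pattern +t = suc (suc (suc zero))
    pattern -t = suc (suc (suc (suc zero)))
    pattern +u = suc (suc (suc (suc (suc zero))))

    unit : Fin 6 → Coord
    unit same = 0 , 0 , 0
    unit +s = 1 , 0 , 0
    unit -s = -1 , 0 , 0
    unit +t = 0 , 1 , 0
    unit -t = 0 , -1 , 0
    unit +u = 0 , 0 , 1

    X-unit : ∀ i → X (unit i) ≈ lookup N i
    X-unit same = trans (identityʳ _) (identityʳ ε)
    X-unit +s = trans (identityʳ _) (trans (identityʳ _) (identityʳ s))
    X-unit -s = trans (identityʳ _) (trans (identityʳ _) (⁻¹-cong (identityʳ s)))
    X-unit +t = trans (identityʳ _) (trans (identityˡ _) (identityʳ t))
    X-unit -t = trans (identityʳ _) (trans (identityˡ _) (⁻¹-cong (identityʳ t)))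
    X-unit +u = trans (∙-cong (identityʳ ε) (identityʳ u)) (identityˡ u)

    X-⊟ : ∀ p q → X (p ⊟ q) ≈ X p ∙ X q ⁻¹
    X-⊟ (a , b , c) (a' , b' , c') = xpt-sub s t u a b c a' b' c'

    offset-index : ∀ {v d} → Within1 G (S₅ G s t u) v d → Σ (Fin 6) λ i → v ∙ d ⁻¹ ≈ lookup N i
    offset-index (inj₁ v≈d) = same , x≈y⇒x∙y⁻¹≈ε v≈d
    offset-index (inj₂ v-d∈S) = suc (Any.index v-d∈S) , lookup-index v-d∈S

    module Around (x : Carrier) where

      pt : Coord → Carrier
      pt p = x ∙ X p

      pt-offset : ∀ r i → pt r ∙ pt (r ⊟ unit i) ⁻¹ ≈ lookup N i
      pt-offset r i = begin
        (x ∙ X r) ∙ (x ∙ X (r ⊟ unit i)) ⁻¹  ≈⟨ xy∙[xz]⁻¹≈y∙z⁻¹ x _ _ ⟩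
        X r ∙ X (r ⊟ unit i) ⁻¹              ≈⟨ ∙-congˡ (⁻¹-cong (X-⊟ r (unit i))) ⟩
        X r ∙ (X r ∙ X (unit i) ⁻¹) ⁻¹       ≈⟨ x∙[x∙y⁻¹]⁻¹≈y _ _ ⟩
        X (unit i)                            ≈⟨ X-unit i ⟩
        lookup N i                            ∎

      pt-+2u : ∀ a b c → pt (a , b , c + 2) ≈ pt (a , b , c)
      pt-+2u a b c = ∙-congˡ (∙-congˡ (begin
        (c + 2) · u    ≈⟨ ·-homo-+ c 2 u ⟩
        c · u ∙ 2 · u  ≈⟨ ∙-congˡ 2u≈ε ⟩
        c · u ∙ ε      ≈⟨ identityʳ _ ⟩
        c · u          ∎))

      within : ∀ r i → Within1 G (S₅ G s t u) (pt r) (pt (r ⊟ unit i))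
      within r same = inj₁ (x∙y⁻¹≈ε⇒x≈y _ _ (pt-offset r same))
      within r (suc k) = inj₂ (∈-resp-≈ setoid (sym (pt-offset r (suc k))) (∈-lookup setoid (S₅ G s t u) k))

      dominator : ∀ r → Σ (Fin 6) λ i → pt (r ⊟ unit i) ∈ᴳ D
      dominator r with proj₁ (perfect (pt r))
      ... | d , d∈D , r~d with offset-index r~d
      ...   | i , r-d≈Nᵢ = i , ∈-resp-≈ setoid d≈ d∈D
        where
        d≈ : d ≈ pt (r ⊟ unit i)
        d≈ = ⁻¹-injective (∙-cancelˡ (pt r) _ _ (trans r-d≈Nᵢ (sym (pt-offset r i))))

      unique-dominator : ∀ r i j → pt (r ⊟ unit i) ∈ᴳ D → pt (r ⊟ unit j) ∈ᴳ D → i ≡ j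
      unique-dominator r i j m m' = lookup-injective distinct i j (begin
        lookup N i                 ≈⟨ pt-offset r i ⟨
        pt r ∙ pt (r ⊟ unit i) ⁻¹  ≈⟨ ∙-congˡ (⁻¹-cong m≈m') ⟩
        pt r ∙ pt (r ⊟ unit j) ⁻¹  ≈⟨ pt-offset r j ⟩
        lookup N j                 ∎)
        where
        m≈m' : pt (r ⊟ unit i) ≈ pt (r ⊟ unit j)
        m≈m' = proj₂ (perfect (pt r)) _ _ m m' (within r i) (within r j)

      module _ (x∈D : x ∈ᴳ D) where

        origin : pt (0 , 0 , 0) ∈ᴳ D
        origin = ∈-resp-≈ setoid (sym (trans (∙-congˡ (X-unit same)) (identityʳ x))) x∈D

        x+2t∉D : ¬ pt (0 , 2 , 0) ∈ᴳ D
        x+2t∉D m = contradiction (unique-dominator (0 , 1 , 0) -t +t m origin) λ ()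

        x+2s+t∉D : pt (0 , 2 , 1) ∈ᴳ D → ¬ pt (2 , 1 , 0) ∈ᴳ D
        x+2s+t∉D a b with dominator (1 , 1 , 1)
        ... | same , m = contradiction (unique-dominator (1 , 2 , 1) +t +s m a) λ ()
        ... | +s , m = contradiction (unique-dominator (0 , 2 , 1) +t same m a) λ ()
        ... | -s , m = contradiction (unique-dominator (2 , 1 , 1) same +u m b) λ ()
        ... | +t , m = contradiction (unique-dominator (0 , 0 , 1) -s +u m origin) λ ()
        ... | -t , m = contradiction (unique-dominator (1 , 2 , 1) same +s m a) λ ()
        ... | +u , m = contradiction (unique-dominator (2 , 1 , 0) +s same m b) λ ()

        x+2t+u∉D : ¬ pt (0 , 2 , 1) ∈ᴳ D
        x+2t+u∉D a with dominator (1 , 1 , 0)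
        ... | same , m = contradiction (unique-dominator (1 , 0 , 0) -t +s m origin) λ ()
        ... | +s , m = contradiction (unique-dominator (0 , 1 , 0) same +t m origin) λ ()
        ... | -s , m = x+2s+t∉D a m
        ... | +t , m = contradiction (unique-dominator (1 , 0 , 0) same +s m origin) λ ()
        ... | -t , m = contradiction (unique-dominator (1 , 2 , 1) +u +s m a) λ ()
        ... | +u , m = contradiction (unique-dominator (1 , 2 , 1) +t +s m' a) λ ()
          where
          m' : pt (1 , 1 , 1) ∈ᴳ D
          m' = ∈-resp-≈ setoid (sym (pt-+2u 1 1 -1)) m

        step : pt (1 , 1 , 1) ∈ᴳ D ⊎ pt (-1 , 1 , 1) ∈ᴳ D
        step with dominator (0 , 1 , 1)
        ... | same , m = contradiction (unique-dominator (0 , 0 , 1) -t +u m origin) λ ()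
        ... | +s , m = inj₂ m
        ... | -s , m = inj₁ m
        ... | +t , m = contradiction (unique-dominator (0 , 0 , 1) same +u m origin) λ ()
        ... | -t , m = contradiction m x+2t+u∉D
        ... | +u , m = contradiction (unique-dominator (0 , 1 , 0) same +t m origin) λ ()

    w₊ w₋ : Carrier
    w₊ = xpt G s t u 1 1 1
    w₋ = xpt G s t u -1 1 1

    rays : ∀ {x} → x ∈ᴳ D → (∀ n → x ∙ n ×ₙ w₊ ∈ᴳ D) ⊎ (∀ n → x ∙ n ×ₙ w₋ ∈ᴳ D)
    rays = ray (∈-resp-≈ setoid) (λ {y} → Around.step y) gap
      where
      gap : ∀ {y} → y ∈ᴳ D → ¬ y ∙ (w₊ ∙ w₋) ∈ᴳ D
      gap {y} y∈D = Around.x+2t∉D y y∈D ∘ ∈-resp-≈ setoid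
        (trans (∙-congˡ (sym (xpt-homo s t u 1 1 1 -1 1 1))) (Around.pt-+2u y 0 2 0))

  module _ (s s' s₀ : Carrier)
    (nonzero : All (_≉ ε) (S₅ G s s' s₀)) (distinct : AllPairs _≉_ (S₅ G s s' s₀))
    (2s₀≈ε : 2 ×ₙ s₀ ≈ ε) (D : List Carrier) (perfect : IsPerfectCode G (S₅ G s s' s₀) D) where

    s₀≈s₀⁻¹ : s₀ ≈ s₀ ⁻¹
    s₀≈s₀⁻¹ = inverseʳ-unique s₀ s₀ (trans (∙-congˡ (sym (identityʳ s₀))) 2s₀≈ε)

    S₅-⁻¹ : S₅ G s s' s₀ ↭ S₅ G (s ⁻¹) (s' ⁻¹) (s₀ ⁻¹)
    S₅-⁻¹ = swap (sym (⁻¹-involutive s)) refl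
              (swap (sym (⁻¹-involutive s')) refl (prep s₀≈s₀⁻¹ ↭-refl))

    distinct₀ : AllPairs _≉_ (ε ∷ S₅ G s s' s₀)
    distinct₀ = All.map ≉-sym nonzero ∷ distinct

    module Forward = PerfectCodeS₅ s s' s₀ distinct₀ 2s₀≈ε D perfect
    module Backward = PerfectCodeS₅ (s ⁻¹) (s' ⁻¹) (s₀ ⁻¹)
      (AllPairs-resp-↭ ≉-sym ≉-resp₂ (prep refl S₅-⁻¹) distinct₀)
      (trans (×ₙ-⁻¹ 2 s₀) (trans (⁻¹-cong 2s₀≈ε) ε⁻¹≈ε))
      D (IsPerfectCode-resp-↭ S₅-⁻¹ perfect)

    lines : ∀ {x} → x ∈ᴳ D → ∀ l → x ∙ l · Forward.w₊ ∈ᴳ D ⊎ x ∙ l · Forward.w₋ ∈ᴳ D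
    lines {x} x∈D (+ n) = Sum.map (forward 1) (forward -1) (Forward.rays x∈D)
      where
      forward : ∀ a → (∀ m → x ∙ m ×ₙ xpt G s s' s₀ a 1 1 ∈ᴳ D) →
                x ∙ (+ n) · xpt G s s' s₀ a 1 1 ∈ᴳ D
      forward a f = ∈-resp-≈ setoid (∙-congˡ (sym (+·≈×ₙ n _))) (f n)
    lines {x} x∈D -[1+ n ] = Sum.map (backward 1) (backward -1) (Backward.rays x∈D)
      where
      backward : ∀ a → (∀ m → x ∙ m ×ₙ xpt G (s ⁻¹) (s' ⁻¹) (s₀ ⁻¹) a 1 1 ∈ᴳ D) →
                 x ∙ -[1+ n ] · xpt G s s' s₀ a 1 1 ∈ᴳ D
      backward a f = ∈-resp-≈ setoid (∙-congˡ (begin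
        suc n ×ₙ xpt G (s ⁻¹) (s' ⁻¹) (s₀ ⁻¹) a 1 1  ≈⟨ ×-congʳ (suc n) (xpt-inverse-generators s s' s₀ a 1 1) ⟩
        suc n ×ₙ (xpt G s s' s₀ a 1 1 ⁻¹)            ≈⟨ ×ₙ-⁻¹ (suc n) _ ⟩
        (suc n ×ₙ xpt G s s' s₀ a 1 1) ⁻¹            ≈⟨ -[1+]·≈×ₙ n _ ⟨
        -[1+ n ] · xpt G s s' s₀ a 1 1               ∎)) (f (suc n))

    perfect-code-diagonals : ∀ i j k → xpt G s s' s₀ i j k ∈ᴳ D → ∀ l →
      xpt G s s' s₀ (i + l) (j + l) (k + l) ∈ᴳ D ⊎ xpt G s s' s₀ (i - l) (j + l) (k + l) ∈ᴳ D
    perfect-code-diagonals i j k x∈D l =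
      Sum.map (∈-resp-≈ setoid shift₊) (∈-resp-≈ setoid shift₋) (lines x∈D l)
      where
      shift₊ : xpt G s s' s₀ i j k ∙ l · Forward.w₊ ≈ xpt G s s' s₀ (i + l) (j + l) (k + l)
      shift₊ = trans (∙-congˡ (sym (xpt-diagonal s s' s₀ l))) (sym (xpt-homo s s' s₀ i j k l l l))
      shift₋ : xpt G s s' s₀ i j k ∙ l · Forward.w₋ ≈ xpt G s s' s₀ (i - l) (j + l) (k + l)
      shift₋ = trans (∙-congˡ (sym (xpt-antidiagonal s s' s₀ l))) (sym (xpt-homo s s' s₀ i j k (- l) l l))

lemma3p2 : ∀ {c ℓ} (G : AbelianGroup c ℓ) →
    IsFinite G →
    Decidable (AbelianGroup._≈_ G) →
    (s s' s₀ : AbelianGroup.Carrier G) →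
    All (λ a → ¬ AbelianGroup._≈_ G a (AbelianGroup.ε G)) (S₅ G s s' s₀) →
    AllPairs (λ a b → ¬ AbelianGroup._≈_ G a b) (S₅ G s s' s₀) →
    Generates G (S₅ G s s' s₀) →
    HasOrder G s₀ 2 →
    OrderGreaterThan G s 2 →
    OrderGreaterThan G s' 2 →
    (D : _) → IsPerfectCode G (S₅ G s s' s₀) D →
    (i j k : ℤ) → _∈_ (AbelianGroup.setoid G) (xpt G s s' s₀ i j k) D →
    (l : ℤ) →
    _∈_ (AbelianGroup.setoid G) (xpt G s s' s₀ (i + l) (j + l) (k + l)) D
    ⊎ _∈_ (AbelianGroup.setoid G) (xpt G s s' s₀ (i - l) (j + l) (k + l)) D
lemma3p2 G _ _ s s' s₀ nonzero distinct _ (_ , 2s₀≈ε , _) _ _ D perfect =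
  perfect-code-diagonals G s s' s₀ nonzero distinct 2s₀≈ε D perfect
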